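{- Let $n,p$ be positive integers with $n\geq 13$, and let $\mathcal{H}\subseteq\binom{[n]}{3}$ with $\nu(\mathcal{H})=1$. Then $co_p(\mathcal{H})\leq co_p(\mathcal{H}_{n,3,1})$, with equality if and only if $\mathcal{H}\cong\mathcal{H}_{n,3,1}$.
   Context: $\nu(\mathcal{H})$ is the largest number of pairwise disjoint members of $\mathcal{H}$. For $E\subseteq[n]$, $d_{\mathcal{H}}(E)=|\{F\in\mathcal{H}:E\subseteq F\}|$, and $co_p(\mathcal{H})=\sum_{E\in\binom{[n]}{2}}(d_{\mathcal{H}}(E))^p$. $\mathcal{H}_{n,3,1}=\{F\in\binom{[n]}{3}: 1\in F\}$. $\cong$ means equality up to a permutation of $[n]$. -}

module Defs where

open import Data.Nat using (ℕ; zero; suc; _+_; _^_; _≤_; _<_; _≡ᵇ_)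
open import Data.Bool using (Bool; true; false; _∧_; if_then_else_)
open import Data.Vec using (Vec; []; _∷_; lookup; tabulate)
open import Data.List using (List; []; _∷_; map; concatMap; length; filter; allFin)
open import Data.Nat.ListAction using (sum)
open import Data.List.Relation.Unary.All using (All)
open import Data.List.Relation.Unary.AllPairs using (AllPairs)
open import Data.List.Relation.Unary.Unique.Propositional using (Unique)
open import Data.List.Membership.Propositional using (_∈_)
open import Data.Fin using (Fin; toℕ; _<?_)
open import Data.Fin.Subset using (Subset; ∣_∣; _∩_; ⊥)
open import Data.Product using (Σ; _×_; _,_; ∃)
open import Function.Bundles using (_↔_; Inverse)
open import Relation.Binary.PropositionalEquality using (_≡_)

Family : ℕ → Set
Family n = Subset n → Bool

Is3Uniform : ∀ {n} → Family n → Set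
Is3Uniform {n} H = ∀ (F : Subset n) → H F ≡ true → ∣ F ∣ ≡ 3

allSubsets : (n : ℕ) → List (Subset n)
allSubsets zero    = [] ∷ []
allSubsets (suc n) = concatMap (λ s → (false ∷ s) ∷ (true ∷ s) ∷ []) (allSubsets n)

members : ∀ {n} → Family n → List (Subset n)
members {n} H = filter (λ F → Data.Bool._≟_ (H F) true) (allSubsets n)
  where import Data.Bool

Disjoint : ∀ {n} → Subset n → Subset n → Set
Disjoint F G = F ∩ G ≡ ⊥

IsMatching : ∀ {n} → Family n → List (Subset n) → Set
IsMatching H M = All (λ F → H F ≡ true) M × Unique M × AllPairs Disjoint M

MatchingNumberIs : ∀ {n} → Family n → ℕ → Set
MatchingNumberIs {n} H k =
  (Σ (List (Subset n)) λ M → IsMatching H M × length M ≡ k)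
  × (∀ (M : List (Subset n)) → IsMatching H M → length M ≤ k)

pairs : (n : ℕ) → List (Fin n × Fin n)
pairs n = concatMap (λ i → map (λ j → (i , j))
                      (filter (λ j → i <? j) (allFin n))) (allFin n)

codeg : ∀ {n} → Family n → Fin n → Fin n → ℕ
codeg {n} H i j = length (filter (λ F → Data.Bool._≟_ (H F ∧ lookup F i ∧ lookup F j) true) (allSubsets n))
  where import Data.Bool

co : ∀ {n} → ℕ → Family n → ℕ
co {n} p H = sum (map (λ { (i , j) → codeg H i j ^ p }) (pairs n))

-- The full star H_{n,3,1}: all 3-subsets containing the first vertex (vertex 1 of [n]).
star : ∀ {n} → Family n
star {zero}  _       = false
star {suc m} (b ∷ s) = b ∧ (∣ s ∣ ≡ᵇ 2)

image : ∀ {n} → (Fin n ↔ Fin n) → Subset n → Subset n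
image σ F = tabulate (λ j → lookup F (Inverse.from σ j))

Iso : ∀ {n} → Family n → Family n → Set
Iso {n} H G = Σ (Fin n ↔ Fin n) λ σ → ∀ (F : Subset n) → H F ≡ G (image σ F)

-- Since ν(H) = 1, H is intersecting. If some vertex v lies in every member, H is contained in
-- the star at v, a relabelling of H_{n,3,1}; co_p is monotone under inclusion, and strictly so
-- when a 3-set is removed, as the codegree of a pair inside it drops.
-- Otherwise every vertex is avoided by some member. A pair avoided by a member G has codegree
-- at most 3, since every member through the pair meets G, so a pair of codegree at least 4
-- ("heavy") meets every member. If no two vertices meet every member, no pair is heavy and
-- |H| ≤ 27. If {x, y} does, then |H| ≤ 5(n − 2), a pair disjoint from {x, y} has codegree at
-- most 2, and so a heavy pair consists of x (or y) and a point of a member avoiding it: there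
-- are at most 6 heavy pairs. As all codegrees are at most n − 2, this gives
-- co_p(H) ≤ 6(n − 2)^p + 3^(p−1)·3|H| (and co_1(H) = 3|H|), which is below
-- co_p(H_{n,3,1}) = (n − 1)(n − 2)^p + C(n − 1, 2) once n ≥ 13.

module Submission where

open import Defs

open import Data.Bool using (Bool; true; false; _∧_; _∨_; not; if_then_else_; T)
import Data.Bool as Bool
open import Data.Bool.Properties using (∧-zeroʳ; ∧-identityʳ; ∨-identityʳ; if-float)
open import Data.Fin using (Fin; zero; suc; _≟_)
import Data.Fin as F
open import Data.Fin.Permutation as Perm using (transpose)
open import Data.Fin.Properties using (any?; all?; ¬∀⟶∃¬) renaming (<⇒≢ to <⇒≢ᶠ)
open import Data.Fin.Subset using (Subset; ∣_∣; inside; outside; ⊥; ⁅_⁆; _∪_; _∩_; _-_; _∉_)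
open import Data.Fin.Subset.Properties
  using ( _⊆?_; anySubset?; ⊆-min; p⊆q⇒∣p∣≤∣q∣; ∣p∣≤n; ∣⊥∣≡0; ∣⁅x⁆∣≡1
        ; ∪-identityˡ; ∪-identityʳ; ∩-idem; Empty-unique; x∈⁅x⁆; x∈⁅y⁆⇒x≡y; x≢y⇒x∉⁅y⁆
        ; x∈p∪q⁻; x∈p∩q⁻; x∈p∧x≢y⇒x∈p-y; x∈p⇒∣p-x∣<∣p∣; p─q⊆p )
open import Data.List using (List; []; _∷_; _++_; map; concatMap; length; filter; allFin)
import Data.List as List
open import Data.List.Membership.Propositional using (_∈_)
open import Data.List.Membership.Propositional.Properties using (∈-concatMap⁺)
open import Data.List.Properties using (map-++; map-∘)
open import Data.List.Relation.Unary.All using ([]; _∷_)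
open import Data.List.Relation.Unary.AllPairs using ([]; _∷_)
open import Data.List.Relation.Unary.Any using (here; there)
import Data.List.Relation.Unary.Any as Any
open import Data.Nat using (ℕ; zero; suc; _+_; _*_; _^_; _∸_; _≤_; _<_; z≤n; s≤s; _≡ᵇ_; _≤?_)
open import Data.Nat.Combinatorics using (_C_; nC1≡n; nCk+nC[k+1]≡[n+1]C[k+1])
open import Data.Nat.ListAction using (sum)
open import Data.Nat.ListAction.Properties using (sum-++)
open import Data.Nat.Properties hiding (_≟_)
open import Data.Nat.Tactic.RingSolver using (solve-∀)
open import Data.Product using (∃; _×_; _,_; proj₁; proj₂)
open import Data.Sum using (_⊎_; inj₁; inj₂; [_,_]′)
open import Data.Vec using ([]; _∷_; lookup)
import Data.Vec as Vec
open import Data.Vec.Properties using ([]=⇒lookup; lookup⇒[]=; lookup∘tabulate)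
open import Function using (_∘_; _$_; id; flip)
open import Function.Bundles using (_↔_; _⇔_; Inverse; mk⇔)
open import Relation.Binary.PropositionalEquality hiding ([_])
open import Relation.Nullary using (Dec; does; yes; no; ¬_; contradiction)
open import Relation.Nullary.Decidable using (dec-true; dec-false; _×-dec_; _⊎-dec_)
open import Relation.Unary using (Decidable)

open import Algebra.Properties.CommutativeSemigroup +-commutativeSemigroup
  using () renaming (interchange to +-interchange)
open import Algebra.Properties.Semiring.Sum +-*-semiring
  using (∑-distrib-+; *-distribˡ-sum; *-distribʳ-sum; sum-cong-≗; sum-replicate-zero; sum-permute)
  renaming (sum to ∑)

𝟙 : Bool → ℕ
𝟙 true  = 1
𝟙 false = 0

𝟙*𝟙>0 : ∀ {a b} → 0 < 𝟙 a * 𝟙 b → a ≡ true × b ≡ true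
𝟙*𝟙>0 {true}  {true}  _  = refl , refl
𝟙*𝟙>0 {true}  {false} ()
𝟙*𝟙>0 {false}         ()

𝟙-∧ : ∀ a b → 𝟙 (a ∧ b) ≡ 𝟙 a * 𝟙 b
𝟙-∧ true  b = sym (+-identityʳ (𝟙 b))
𝟙-∧ false b = refl

count : {A : Set} → (A → Bool) → List A → ℕ
count P []       = 0
count P (x ∷ xs) = 𝟙 (P x) + count P xs

module _ {A : Set} where

  length-filter≡count : ∀ (P : A → Bool) xs →
    length (filter (λ x → Bool._≟_ (P x) true) xs) ≡ count P xs
  length-filter≡count P []       = refl
  length-filter≡count P (x ∷ xs) with P x
  ... | true  = cong suc (length-filter≡count P xs)
  ... | false = length-filter≡count P xs

  count-cong : ∀ {P Q : A → Bool} → (∀ x → P x ≡ Q x) → ∀ xs → count P xs ≡ count Q xs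
  count-cong P≗Q []       = refl
  count-cong P≗Q (x ∷ xs) = cong₂ _+_ (cong 𝟙 (P≗Q x)) (count-cong P≗Q xs)

  𝟙-mono : ∀ {a b} → (a ≡ true → b ≡ true) → 𝟙 a ≤ 𝟙 b
  𝟙-mono {false} a⇒b = z≤n
  𝟙-mono {true}  a⇒b rewrite a⇒b refl = ≤-refl

  count-mono : ∀ {P Q : A → Bool} → (∀ x → P x ≡ true → Q x ≡ true) →
    ∀ xs → count P xs ≤ count Q xs
  count-mono P⇒Q []       = z≤n
  count-mono P⇒Q (x ∷ xs) = +-mono-≤ (𝟙-mono (P⇒Q x)) (count-mono P⇒Q xs)

  count-mono-< : ∀ {P Q : A → Bool} → (∀ x → P x ≡ true → Q x ≡ true) →
    ∀ {x xs} → x ∈ xs → Q x ≡ true → P x ≡ false → count P xs < count Q xs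
  count-mono-< {P} {Q} P⇒Q {xs = y ∷ ys} (here refl) Qx ¬Px rewrite Qx | ¬Px =
    s≤s (count-mono P⇒Q ys)
  count-mono-< P⇒Q {xs = y ∷ ys} (there x∈ys) Qx ¬Px =
    +-mono-≤-< (𝟙-mono (P⇒Q y)) (count-mono-< P⇒Q x∈ys Qx ¬Px)

  count-split : ∀ (P Q : A → Bool) xs →
    count P xs ≡ count (λ x → P x ∧ Q x) xs + count (λ x → P x ∧ not (Q x)) xs
  count-split P Q []       = refl
  count-split P Q (x ∷ xs) = begin
    𝟙 (P x) + count P xs
      ≡⟨ cong₂ _+_ (split (P x) (Q x)) (count-split P Q xs) ⟩
    (𝟙 (P x ∧ Q x) + 𝟙 (P x ∧ not (Q x))) + (count _ xs + count _ xs)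
      ≡⟨ +-interchange (𝟙 (P x ∧ Q x)) _ _ _ ⟩
    count (λ x → P x ∧ Q x) (x ∷ xs) + count (λ x → P x ∧ not (Q x)) (x ∷ xs) ∎
    where
    open ≡-Reasoning
    split : ∀ a b → 𝟙 a ≡ 𝟙 (a ∧ b) + 𝟙 (a ∧ not b)
    split false b     = refl
    split true  false = refl
    split true  true  = refl

  count-union : ∀ {P Q R : A → Bool} → (∀ x → P x ≡ true → Q x ≡ true ⊎ R x ≡ true) →
    ∀ xs → count P xs ≤ count Q xs + count R xs
  count-union P⇒Q∨R []       = z≤n
  count-union {P} {Q} {R} P⇒Q∨R (x ∷ xs) = begin
    𝟙 (P x) + count P xs
      ≤⟨ +-mono-≤ (first (P x) (P⇒Q∨R x)) (count-union P⇒Q∨R xs) ⟩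
    (𝟙 (Q x) + 𝟙 (R x)) + (count Q xs + count R xs)
      ≡⟨ +-interchange (𝟙 (Q x)) _ _ _ ⟩
    count Q (x ∷ xs) + count R (x ∷ xs) ∎
    where
    open ≤-Reasoning
    first : ∀ a → (a ≡ true → Q x ≡ true ⊎ R x ≡ true) → 𝟙 a ≤ 𝟙 (Q x) + 𝟙 (R x)
    first false _ = z≤n
    first true  h with h refl
    ... | inj₁ Qx rewrite Qx = s≤s z≤n
    ... | inj₂ Rx rewrite Rx = m≤n+m 1 (𝟙 (Q x))

count-none : ∀ {A : Set} {P : A → Bool} → (∀ x → P x ≡ false) → ∀ xs → count P xs ≡ 0
count-none ¬P []       = refl
count-none ¬P (x ∷ xs) rewrite ¬P x = count-none ¬P xs

∑-mono-≤ : ∀ {n} {f g : Fin n → ℕ} → (∀ i → f i ≤ g i) → ∑ f ≤ ∑ g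
∑-mono-≤ {zero}  f≤g = z≤n
∑-mono-≤ {suc n} f≤g = +-mono-≤ (f≤g zero) (∑-mono-≤ (f≤g ∘ suc))

∑-mono-< : ∀ {n} {f g : Fin n → ℕ} → (∀ i → f i ≤ g i) → ∀ i → f i < g i → ∑ f < ∑ g
∑-mono-< f≤g zero    fi<gi = +-mono-<-≤ fi<gi (∑-mono-≤ (f≤g ∘ suc))
∑-mono-< f≤g (suc i) fi<gi = +-mono-≤-< (f≤g zero) (∑-mono-< (f≤g ∘ suc) i fi<gi)

≤-∑ : ∀ {n} (f : Fin n → ℕ) i → f i ≤ ∑ f
≤-∑ f zero    = m≤m+n (f zero) _
≤-∑ f (suc i) = ≤-trans (≤-∑ (f ∘ suc) i) (m≤n+m _ (f zero))

∑-const : ∀ n c → ∑ {n} (λ _ → c) ≡ n * c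
∑-const zero    c = refl
∑-const (suc n) c = cong (c +_) (∑-const n c)

∑-pos : ∀ {n} (f : Fin n → ℕ) → 0 < ∑ f → ∃ λ i → 0 < f i
∑-pos {suc n} f pos with f zero in f0
... | suc _ = zero , subst (0 <_) (sym f0) (s≤s z≤n)
... | zero with ∑-pos (f ∘ suc) pos
...   | i , fi>0 = suc i , fi>0

∣∷∣ : ∀ {n} b (F : Subset n) → ∣ b ∷ F ∣ ≡ 𝟙 b + ∣ F ∣
∣∷∣ true  F = refl
∣∷∣ false F = refl

∣∣≡∑𝟙 : ∀ {n} (F : Subset n) → ∣ F ∣ ≡ ∑ (𝟙 ∘ lookup F)
∣∣≡∑𝟙 []      = refl
∣∣≡∑𝟙 (b ∷ F) = trans (∣∷∣ b F) (cong (𝟙 b +_) (∣∣≡∑𝟙 F))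

count-≤-cover : ∀ {n} {X : Set} {P : X → Bool} (A : Subset n) (Q : Fin n → X → Bool) {c} xs →
  (∀ x → P x ≡ true → ∃ λ g → lookup A g ≡ true × Q g x ≡ true) →
  (∀ g → lookup A g ≡ true → count (Q g) xs ≤ c) →
  count P xs ≤ c * ∣ A ∣
count-≤-cover {n} {P = P} A Q {c} xs charge bound = begin
  count P xs                                  ≤⟨ charged xs ⟩
  ∑ (λ g → 𝟙 (lookup A g) * count (Q g) xs)  ≤⟨ ∑-mono-≤ bounded ⟩
  ∑ (λ g → c * 𝟙 (lookup A g))               ≡⟨ *-distribˡ-sum c (𝟙 ∘ lookup A) ⟨
  c * ∑ (𝟙 ∘ lookup A)                        ≡⟨ cong (c *_) (∣∣≡∑𝟙 A) ⟨
  c * ∣ A ∣                                   ∎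
  where
  open ≤-Reasoning
  hit : ∀ x → 𝟙 (P x) ≤ ∑ (λ g → 𝟙 (lookup A g) * 𝟙 (Q g x))
  hit x with P x in Px
  ... | false = z≤n
  ... | true with charge x Px
  ...   | g , Ag , Qgx = ≤-trans (≤-reflexive (cong₂ (λ a q → 𝟙 a * 𝟙 q) (sym Ag) (sym Qgx)))
                                 (≤-∑ (λ g → 𝟙 (lookup A g) * 𝟙 (Q g x)) g)
  charged : ∀ xs → count P xs ≤ ∑ (λ g → 𝟙 (lookup A g) * count (Q g) xs)
  charged []       =
    ≤-reflexive (sym (trans (sum-cong-≗ (λ g → *-zeroʳ (𝟙 (lookup A g)))) (sum-replicate-zero n)))
  charged (x ∷ xs) = begin
    𝟙 (P x) + count P xs
      ≤⟨ +-mono-≤ (hit x) (charged xs) ⟩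
    ∑ (λ g → 𝟙 (lookup A g) * 𝟙 (Q g x)) + ∑ (λ g → 𝟙 (lookup A g) * count (Q g) xs)
      ≡⟨ ∑-distrib-+ (λ g → 𝟙 (lookup A g) * 𝟙 (Q g x)) _ ⟨
    ∑ (λ g → 𝟙 (lookup A g) * 𝟙 (Q g x) + 𝟙 (lookup A g) * count (Q g) xs)
      ≡⟨ sum-cong-≗ (λ g → *-distribˡ-+ (𝟙 (lookup A g)) _ _) ⟨
    ∑ (λ g → 𝟙 (lookup A g) * count (Q g) (x ∷ xs)) ∎
  bounded : ∀ g → 𝟙 (lookup A g) * count (Q g) xs ≤ c * 𝟙 (lookup A g)
  bounded g with lookup A g in Ag
  ... | false = z≤n
  ... | true  = begin
    count (Q g) xs + 0  ≡⟨ +-identityʳ _ ⟩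
    count (Q g) xs      ≤⟨ bound g Ag ⟩
    c                   ≡⟨ *-identityʳ c ⟨
    c * 1               ∎

-- Subsets of a given size

countSubsets : ∀ {n} → (Subset n → Bool) → ℕ
countSubsets {n} P = count P (allSubsets n)

countSubsets-∷ : ∀ {n} (P : Subset (suc n) → Bool) →
  countSubsets P ≡ countSubsets (P ∘ (false ∷_)) + countSubsets (P ∘ (true ∷_))
countSubsets-∷ {n} P = go (allSubsets n)
  where
  step : List (Subset n) → List (Subset (suc n))
  step = concatMap (λ F → (false ∷ F) ∷ (true ∷ F) ∷ [])
  go : ∀ Fs → count P (step Fs) ≡ count (P ∘ (false ∷_)) Fs + count (P ∘ (true ∷_)) Fs
  go []       = refl
  go (F ∷ Fs) = begin
    a + (b + count P (step Fs))  ≡⟨ +-assoc a b _ ⟨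
    (a + b) + count P (step Fs)  ≡⟨ cong ((a + b) +_) (go Fs) ⟩
    (a + b) + (count (P ∘ (false ∷_)) Fs + count (P ∘ (true ∷_)) Fs)
                                 ≡⟨ +-interchange a b _ _ ⟩
    count (P ∘ (false ∷_)) (F ∷ Fs) + count (P ∘ (true ∷_)) (F ∷ Fs) ∎
    where
    open ≡-Reasoning
    a = 𝟙 (P (false ∷ F))
    b = 𝟙 (P (true ∷ F))

∈-allSubsets : ∀ {n} (F : Subset n) → F ∈ allSubsets n
∈-allSubsets []      = here refl
∈-allSubsets (b ∷ F) = ∈-concatMap⁺ _ (Any.map (λ { refl → ∷-listed b }) (∈-allSubsets F))
  where
  ∷-listed : ∀ b → (b ∷ F) ∈ (false ∷ F) ∷ (true ∷ F) ∷ []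
  ∷-listed false = here refl
  ∷-listed true  = there (here refl)

#supersets : ∀ {n} → ℕ → Subset n → ℕ
#supersets m S = countSubsets (λ F → (∣ F ∣ ≡ᵇ m) ∧ does (S ⊆? F))

#supersets-C : ∀ {n} (S : Subset n) t → #supersets (∣ S ∣ + t) S ≡ (n ∸ ∣ S ∣) C t
#supersets-C []      zero    = refl
#supersets-C []      (suc t) = refl
#supersets-C {suc n} (inside ∷ S) t =
  trans (countSubsets-∷ (λ F → (∣ F ∣ ≡ᵇ suc ∣ S ∣ + t) ∧ does (inside ∷ S ⊆? F))) $ begin
  countSubsets {n} (λ F → (∣ F ∣ ≡ᵇ suc ∣ S ∣ + t) ∧ false) + #supersets (∣ S ∣ + t) S
    ≡⟨ cong₂ _+_ (count-none (λ F → ∧-zeroʳ _) (allSubsets n)) (#supersets-C S t) ⟩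
  (n ∸ ∣ S ∣) C t ∎
  where open ≡-Reasoning
#supersets-C {suc n} (outside ∷ S) zero =
  trans (countSubsets-∷ (λ F → (∣ F ∣ ≡ᵇ ∣ S ∣ + 0) ∧ does (outside ∷ S ⊆? F))) $ begin
  #supersets {n} (∣ S ∣ + 0) S
    + countSubsets {n} (λ F → (suc ∣ F ∣ ≡ᵇ ∣ S ∣ + 0) ∧ does (S ⊆? F))
    ≡⟨ cong₂ _+_ (#supersets-C S 0) (count-none too-big (allSubsets n)) ⟩
  1 ∎
  where
  open ≡-Reasoning
  too-big : ∀ F → (suc ∣ F ∣ ≡ᵇ ∣ S ∣ + 0) ∧ does (S ⊆? F) ≡ false
  too-big F with S ⊆? F
  ... | no  _   = ∧-zeroʳ _
  ... | yes S⊆F with suc ∣ F ∣ ≡ᵇ ∣ S ∣ + 0 in eq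
  ...   | false = refl
  ...   | true  = contradiction (p⊆q⇒∣p∣≤∣q∣ S⊆F)
                    (<⇒≱ (≤-reflexive (trans (≡ᵇ⇒≡ _ _ (subst T (sym eq) _)) (+-identityʳ ∣ S ∣))))
#supersets-C {suc n} (outside ∷ S) (suc t) =
  trans (countSubsets-∷ (λ F → (∣ F ∣ ≡ᵇ ∣ S ∣ + suc t) ∧ does (outside ∷ S ⊆? F))) $ begin
  #supersets {n} (∣ S ∣ + suc t) S
    + countSubsets {n} (λ F → (suc ∣ F ∣ ≡ᵇ ∣ S ∣ + suc t) ∧ does (S ⊆? F))
    ≡⟨ cong (#supersets (∣ S ∣ + suc t) S +_)
            (count-cong (λ F → cong (λ m → (suc ∣ F ∣ ≡ᵇ m) ∧ does (S ⊆? F)) (+-suc ∣ S ∣ t))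
                        (allSubsets n)) ⟩
  #supersets {n} (∣ S ∣ + suc t) S + #supersets (∣ S ∣ + t) S
    ≡⟨ cong₂ _+_ (#supersets-C S (suc t)) (#supersets-C S t) ⟩
  (n ∸ ∣ S ∣) C suc t + (n ∸ ∣ S ∣) C t
    ≡⟨ +-comm ((n ∸ ∣ S ∣) C suc t) _ ⟩
  (n ∸ ∣ S ∣) C t + (n ∸ ∣ S ∣) C suc t
    ≡⟨ nCk+nC[k+1]≡[n+1]C[k+1] (n ∸ ∣ S ∣) t ⟩
  suc (n ∸ ∣ S ∣) C suc t
    ≡⟨ cong (_C suc t) (+-∸-assoc 1 (∣p∣≤n S)) ⟨
  (suc n ∸ ∣ S ∣) C suc t ∎
  where open ≡-Reasoning

⊥⊆? : ∀ {n} (F : Subset n) → does (⊥ ⊆? F) ≡ true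
⊥⊆? F = dec-true (⊥ ⊆? F) (⊆-min F)

⁅⁆∪⊆? : ∀ {n} (i : Fin n) (p F : Subset n) → does (⁅ i ⁆ ∪ p ⊆? F) ≡ lookup F i ∧ does (p ⊆? F)
⁅⁆∪⊆? zero    (s ∷ p)       (false ∷ F) = refl
⁅⁆∪⊆? zero    (false ∷ p)   (true ∷ F)  = cong (λ q → does (q ⊆? F)) (∪-identityˡ p)
⁅⁆∪⊆? zero    (true ∷ p)    (true ∷ F)  = cong (λ q → does (q ⊆? F)) (∪-identityˡ p)
⁅⁆∪⊆? (suc i) (false ∷ p)   (f ∷ F)     = ⁅⁆∪⊆? i p F
⁅⁆∪⊆? (suc i) (true ∷ p)    (false ∷ F) = sym (∧-zeroʳ (lookup F i))
⁅⁆∪⊆? (suc i) (true ∷ p)    (true ∷ F)  = ⁅⁆∪⊆? i p F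

⁅⁆⊆? : ∀ {n} (i : Fin n) (F : Subset n) → does (⁅ i ⁆ ⊆? F) ≡ lookup F i
⁅⁆⊆? i F = begin
  does (⁅ i ⁆ ⊆? F)          ≡⟨ cong (λ q → does (q ⊆? F)) (∪-identityʳ ⁅ i ⁆) ⟨
  does (⁅ i ⁆ ∪ ⊥ ⊆? F)      ≡⟨ ⁅⁆∪⊆? i ⊥ F ⟩
  lookup F i ∧ does (⊥ ⊆? F) ≡⟨ cong (lookup F i ∧_) (⊥⊆? F) ⟩
  lookup F i ∧ true          ≡⟨ ∧-identityʳ (lookup F i) ⟩
  lookup F i                 ∎
  where open ≡-Reasoning

∣⁅⁆∪∣ : ∀ {n} {i : Fin n} {p} → i ∉ p → ∣ ⁅ i ⁆ ∪ p ∣ ≡ suc ∣ p ∣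
∣⁅⁆∪∣ {i = zero}  {false ∷ p} i∉p = cong suc (cong ∣_∣ (∪-identityˡ p))
∣⁅⁆∪∣ {i = zero}  {true ∷ p}  i∉p = contradiction Vec.here i∉p
∣⁅⁆∪∣ {i = suc i} {s ∷ p}     i∉p = begin
  ∣ s ∷ (⁅ i ⁆ ∪ p) ∣   ≡⟨ ∣∷∣ s (⁅ i ⁆ ∪ p) ⟩
  𝟙 s + ∣ ⁅ i ⁆ ∪ p ∣   ≡⟨ cong (𝟙 s +_) (∣⁅⁆∪∣ (i∉p ∘ Vec.there)) ⟩
  𝟙 s + suc ∣ p ∣       ≡⟨ +-suc (𝟙 s) ∣ p ∣ ⟩
  suc (𝟙 s + ∣ p ∣)     ≡⟨ cong suc (∣∷∣ s p) ⟨
  suc ∣ s ∷ p ∣         ∎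
  where open ≡-Reasoning

countSubsets-3⊇pair : ∀ {n} {i j : Fin n} → i ≢ j →
  countSubsets (λ F → (∣ F ∣ ≡ᵇ 3) ∧ (lookup F i ∧ lookup F j)) ≡ n ∸ 2
countSubsets-3⊇pair {n} {i} {j} i≢j = begin
  countSubsets (λ F → (∣ F ∣ ≡ᵇ 3) ∧ (lookup F i ∧ lookup F j))
    ≡⟨ count-cong (λ F → cong₂ (λ m b → (∣ F ∣ ≡ᵇ m) ∧ b) size (includes F)) (allSubsets n) ⟨
  #supersets (∣ S ∣ + 1) S
    ≡⟨ #supersets-C S 1 ⟩
  (n ∸ ∣ S ∣) C 1
    ≡⟨ nC1≡n (n ∸ ∣ S ∣) ⟩
  n ∸ ∣ S ∣
    ≡⟨ cong (n ∸_) ∣S∣≡2 ⟩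
  n ∸ 2 ∎
  where
  open ≡-Reasoning
  S = ⁅ i ⁆ ∪ ⁅ j ⁆
  ∣S∣≡2 : ∣ S ∣ ≡ 2
  ∣S∣≡2 = trans (∣⁅⁆∪∣ (x≢y⇒x∉⁅y⁆ i≢j)) (cong suc (∣⁅x⁆∣≡1 j))
  size : ∣ S ∣ + 1 ≡ 3
  size = cong (_+ 1) ∣S∣≡2
  includes : ∀ F → does (S ⊆? F) ≡ lookup F i ∧ lookup F j
  includes F = trans (⁅⁆∪⊆? i ⁅ j ⁆ F) (cong (lookup F i ∧_) (⁅⁆⊆? j F))

countSubsets-3⊇triple : ∀ {n} {i j k : Fin n} → i ≢ j → i ≢ k → j ≢ k →
  countSubsets (λ F → (∣ F ∣ ≡ᵇ 3) ∧ (lookup F i ∧ (lookup F j ∧ lookup F k))) ≡ 1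
countSubsets-3⊇triple {n} {i} {j} {k} i≢j i≢k j≢k = begin
  countSubsets (λ F → (∣ F ∣ ≡ᵇ 3) ∧ (lookup F i ∧ (lookup F j ∧ lookup F k)))
    ≡⟨ count-cong (λ F → cong₂ (λ m b → (∣ F ∣ ≡ᵇ m) ∧ b) size (includes F)) (allSubsets n) ⟨
  #supersets (∣ S ∣ + 0) S
    ≡⟨ #supersets-C S 0 ⟩
  1 ∎
  where
  open ≡-Reasoning
  S = ⁅ i ⁆ ∪ (⁅ j ⁆ ∪ ⁅ k ⁆)
  i∉jk : i ∉ ⁅ j ⁆ ∪ ⁅ k ⁆
  i∉jk i∈jk with x∈p∪q⁻ ⁅ j ⁆ ⁅ k ⁆ i∈jk
  ... | inj₁ i∈j = i≢j (x∈⁅y⁆⇒x≡y j i∈j)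
  ... | inj₂ i∈k = i≢k (x∈⁅y⁆⇒x≡y k i∈k)
  size : ∣ S ∣ + 0 ≡ 3
  size = begin
    ∣ S ∣ + 0              ≡⟨ +-identityʳ ∣ S ∣ ⟩
    ∣ S ∣                  ≡⟨ ∣⁅⁆∪∣ i∉jk ⟩
    suc ∣ ⁅ j ⁆ ∪ ⁅ k ⁆ ∣  ≡⟨ cong suc (∣⁅⁆∪∣ (x≢y⇒x∉⁅y⁆ j≢k)) ⟩
    suc (suc ∣ ⁅ k ⁆ ∣)    ≡⟨ cong (2 +_) (∣⁅x⁆∣≡1 k) ⟩
    3                      ∎
  includes : ∀ F → does (S ⊆? F) ≡ lookup F i ∧ (lookup F j ∧ lookup F k)
  includes F = begin
    does (S ⊆? F)
      ≡⟨ ⁅⁆∪⊆? i (⁅ j ⁆ ∪ ⁅ k ⁆) F ⟩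
    lookup F i ∧ does (⁅ j ⁆ ∪ ⁅ k ⁆ ⊆? F)
      ≡⟨ cong (lookup F i ∧_) (⁅⁆∪⊆? j ⁅ k ⁆ F) ⟩
    lookup F i ∧ (lookup F j ∧ does (⁅ k ⁆ ⊆? F))
      ≡⟨ cong (λ b → lookup F i ∧ (lookup F j ∧ b)) (⁅⁆⊆? k F) ⟩
    lookup F i ∧ (lookup F j ∧ lookup F k) ∎

-- Sums over pairs

[1+n]C2 : ∀ n → suc n C 2 ≡ n + n C 2
[1+n]C2 n = trans (sym (nCk+nC[k+1]≡[n+1]C[k+1] n 1)) (cong (_+ n C 2) (nC1≡n n))

0<C2 : ∀ {m} → 2 ≤ m → 0 < m C 2
0<C2 {suc zero}    (s≤s ())
0<C2 {suc (suc k)} _ = subst (0 <_) (sym ([1+n]C2 (suc k))) (s≤s z≤n)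

2*[1+m]C2 : ∀ m → 2 * (suc m C 2) ≡ suc m * m
2*[1+m]C2 zero    = refl
2*[1+m]C2 (suc m) = begin
  2 * (suc (suc m) C 2)         ≡⟨ cong (2 *_) ([1+n]C2 (suc m)) ⟩
  2 * (suc m + suc m C 2)       ≡⟨ *-distribˡ-+ 2 (suc m) _ ⟩
  2 * suc m + 2 * (suc m C 2)   ≡⟨ cong (2 * suc m +_) (2*[1+m]C2 m) ⟩
  2 * suc m + suc m * m         ≡⟨ expand m ⟩
  suc (suc m) * suc m           ∎
  where
  open ≡-Reasoning
  expand : ∀ m → 2 * suc m + suc m * m ≡ suc (suc m) * suc m
  expand = solve-∀

-- The sum of f i j over i < j.
pairSum : ∀ {n} → (Fin n → Fin n → ℕ) → ℕ
pairSum {zero}  f = 0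
pairSum {suc n} f = ∑ (λ j → f zero (suc j)) + pairSum (λ i j → f (suc i) (suc j))

pairSum-mono-≤ : ∀ {n} {f g : Fin n → Fin n → ℕ} → (∀ i j → i F.< j → f i j ≤ g i j) →
  pairSum f ≤ pairSum g
pairSum-mono-≤ {zero}  f≤g = z≤n
pairSum-mono-≤ {suc n} f≤g = +-mono-≤ (∑-mono-≤ (λ j → f≤g zero (suc j) (s≤s z≤n)))
                                      (pairSum-mono-≤ (λ i j i<j → f≤g (suc i) (suc j) (s≤s i<j)))

pairSum-cong : ∀ {n} {f g : Fin n → Fin n → ℕ} → (∀ i j → i F.< j → f i j ≡ g i j) →
  pairSum f ≡ pairSum g
pairSum-cong f≡g = ≤-antisym (pairSum-mono-≤ (λ i j i<j → ≤-reflexive (f≡g i j i<j)))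
                             (pairSum-mono-≤ (λ i j i<j → ≤-reflexive (sym (f≡g i j i<j))))

pairSum-mono-< : ∀ {n} {f g : Fin n → Fin n → ℕ} → (∀ i j → i F.< j → f i j ≤ g i j) →
  ∀ {i j} → i F.< j → f i j < g i j → pairSum f < pairSum g
pairSum-mono-< {suc n} f≤g {zero} {suc j} _ fij<gij =
  +-mono-<-≤ (∑-mono-< (λ j → f≤g zero (suc j) (s≤s z≤n)) j fij<gij)
             (pairSum-mono-≤ (λ i j i<j → f≤g (suc i) (suc j) (s≤s i<j)))
pairSum-mono-< {suc n} f≤g {suc i} {suc j} (s≤s i<j) fij<gij =
  +-mono-≤-< (∑-mono-≤ (λ j → f≤g zero (suc j) (s≤s z≤n)))
             (pairSum-mono-< (λ i j i<j → f≤g (suc i) (suc j) (s≤s i<j)) i<j fij<gij)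

pairSum-+ : ∀ {n} (f g : Fin n → Fin n → ℕ) →
  pairSum (λ i j → f i j + g i j) ≡ pairSum f + pairSum g
pairSum-+ {zero}  f g = refl
pairSum-+ {suc n} f g = begin
  ∑ (λ j → f zero (suc j) + g zero (suc j)) + pairSum (λ i j → f (suc i) (suc j) + g (suc i) (suc j))
    ≡⟨ cong₂ _+_ (∑-distrib-+ (λ j → f zero (suc j)) (λ j → g zero (suc j)))
                 (pairSum-+ (λ i j → f (suc i) (suc j)) (λ i j → g (suc i) (suc j))) ⟩
  (∑ (λ j → f zero (suc j)) + ∑ (λ j → g zero (suc j)))
    + (pairSum (λ i j → f (suc i) (suc j)) + pairSum (λ i j → g (suc i) (suc j)))
    ≡⟨ +-interchange (∑ (λ j → f zero (suc j))) _ _ _ ⟩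
  pairSum f + pairSum g ∎
  where open ≡-Reasoning

pairSum-* : ∀ {n} c (f : Fin n → Fin n → ℕ) → pairSum (λ i j → c * f i j) ≡ c * pairSum f
pairSum-* {zero}  c f = sym (*-zeroʳ c)
pairSum-* {suc n} c f =
  trans (cong₂ _+_ (sym (*-distribˡ-sum c (λ j → f zero (suc j))))
                   (pairSum-* c (λ i j → f (suc i) (suc j))))
        (sym (*-distribˡ-+ c _ _))

pairSum-const : ∀ n c → pairSum {n} (λ _ _ → c) ≡ (n C 2) * c
pairSum-const zero    c = refl
pairSum-const (suc n) c = begin
  ∑ {n} (λ _ → c) + pairSum {n} (λ _ _ → c) ≡⟨ cong₂ _+_ (∑-const n c) (pairSum-const n c) ⟩
  n * c + (n C 2) * c                       ≡⟨ *-distribʳ-+ c n (n C 2) ⟨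
  (n + n C 2) * c                           ≡⟨ cong (_* c) ([1+n]C2 n) ⟨
  (suc n C 2) * c                           ∎
  where open ≡-Reasoning

pairSum-pos : ∀ {n} (f : Fin n → Fin n → ℕ) → 0 < pairSum f →
  ∃ λ i → ∃ λ j → i F.< j × 0 < f i j
pairSum-pos {suc n} f pos with ∑ (λ j → f zero (suc j)) in row
... | suc _ with ∑-pos (λ j → f zero (suc j)) (subst (0 <_) (sym row) (s≤s z≤n))
...   | j , fj>0 = zero , suc j , s≤s z≤n , fj>0
pairSum-pos {suc n} f pos | zero with pairSum-pos (λ i j → f (suc i) (suc j)) pos
...   | i , j , i<j , fij>0 = suc i , suc j , s≤s i<j , fij>0

pairSum-≤-∑*∑ : ∀ {n} (a b : Fin n → ℕ) → pairSum (λ i j → a i * b j + a j * b i) ≤ ∑ a * ∑ b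
pairSum-≤-∑*∑ {zero}  a b = z≤n
pairSum-≤-∑*∑ {suc n} a b = begin
  ∑ (λ j → a₀ * b (suc j) + a (suc j) * b₀)
    + pairSum (λ i j → a (suc i) * b (suc j) + a (suc j) * b (suc i))
    ≤⟨ +-mono-≤ (≤-reflexive first-row) (pairSum-≤-∑*∑ (a ∘ suc) (b ∘ suc)) ⟩
  (a₀ * B + A * b₀) + A * B
    ≤⟨ m≤n+m _ (a₀ * b₀) ⟩
  a₀ * b₀ + ((a₀ * B + A * b₀) + A * B)
    ≡⟨ expand a₀ b₀ A B ⟨
  (a₀ + A) * (b₀ + B) ∎
  where
  open ≤-Reasoning
  a₀ = a zero
  b₀ = b zero
  A = ∑ (a ∘ suc)
  B = ∑ (b ∘ suc)
  expand : ∀ a₀ b₀ A B → (a₀ + A) * (b₀ + B) ≡ a₀ * b₀ + ((a₀ * B + A * b₀) + A * B)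
  expand = solve-∀
  first-row : ∑ (λ j → a₀ * b (suc j) + a (suc j) * b₀) ≡ a₀ * B + A * b₀
  first-row = begin-equality
    ∑ (λ j → a₀ * b (suc j) + a (suc j) * b₀)
      ≡⟨ ∑-distrib-+ (λ j → a₀ * b (suc j)) _ ⟩
    ∑ (λ j → a₀ * b (suc j)) + ∑ (λ j → a (suc j) * b₀)
      ≡⟨ cong₂ _+_ (*-distribˡ-sum a₀ (b ∘ suc)) (*-distribʳ-sum b₀ (a ∘ suc)) ⟨
    a₀ * B + A * b₀                                   ∎

pairsThrough : ∀ {n} → Fin n → Subset n → Fin n → Fin n → ℕ
pairsThrough v G i j =
  𝟙 (lookup ⁅ v ⁆ i) * 𝟙 (lookup G j) + 𝟙 (lookup ⁅ v ⁆ j) * 𝟙 (lookup G i)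

pairSum-pairsThrough : ∀ {n} (v : Fin n) G → pairSum (pairsThrough v G) ≤ ∣ G ∣
pairSum-pairsThrough v G = begin
  pairSum (pairsThrough v G)
    ≤⟨ pairSum-≤-∑*∑ (𝟙 ∘ lookup ⁅ v ⁆) (𝟙 ∘ lookup G) ⟩
  ∑ (𝟙 ∘ lookup ⁅ v ⁆) * ∑ (𝟙 ∘ lookup G)
    ≡⟨ cong₂ _*_ (∣∣≡∑𝟙 ⁅ v ⁆) (∣∣≡∑𝟙 G) ⟨
  ∣ ⁅ v ⁆ ∣ * ∣ G ∣                      ≡⟨ cong (_* ∣ G ∣) (∣⁅x⁆∣≡1 v) ⟩
  1 * ∣ G ∣                              ≡⟨ *-identityˡ ∣ G ∣ ⟩
  ∣ G ∣                                  ∎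
  where open ≤-Reasoning

pairsThrough-hit : ∀ {n} {v : Fin n} {G i j} →
  (i ≡ v × lookup G j ≡ true) ⊎ (j ≡ v × lookup G i ≡ true) → 1 ≤ pairsThrough v G i j
pairsThrough-hit {v = v} (inj₁ (refl , Gj)) =
  ≤-trans (≤-reflexive (cong₂ (λ a b → 𝟙 a * 𝟙 b) (sym ([]=⇒lookup (x∈⁅x⁆ v))) (sym Gj))) (m≤m+n _ _)
pairsThrough-hit {v = v} (inj₂ (refl , Gi)) =
  ≤-trans (≤-reflexive (cong₂ (λ a b → 𝟙 a * 𝟙 b) (sym ([]=⇒lookup (x∈⁅x⁆ v))) (sym Gi))) (m≤n+m _ _)

pairSum-inside : ∀ {n} (F : Subset n) →
  pairSum (λ i j → 𝟙 (lookup F i) * 𝟙 (lookup F j)) ≡ ∣ F ∣ C 2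
pairSum-inside []      = refl
pairSum-inside (b ∷ F) = begin
  ∑ (λ j → 𝟙 b * 𝟙 (lookup F j)) + pairSum (λ i j → 𝟙 (lookup F i) * 𝟙 (lookup F j))
    ≡⟨ cong₂ _+_ (sym (*-distribˡ-sum (𝟙 b) (𝟙 ∘ lookup F))) (pairSum-inside F) ⟩
  𝟙 b * ∑ (𝟙 ∘ lookup F) + ∣ F ∣ C 2
    ≡⟨ cong (λ m → 𝟙 b * m + ∣ F ∣ C 2) (∣∣≡∑𝟙 F) ⟨
  𝟙 b * ∣ F ∣ + ∣ F ∣ C 2
    ≡⟨ add b ⟩
  ∣ b ∷ F ∣ C 2 ∎
  where
  open ≡-Reasoning
  add : ∀ b → 𝟙 b * ∣ F ∣ + ∣ F ∣ C 2 ≡ ∣ b ∷ F ∣ C 2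
  add true  = trans (cong (_+ ∣ F ∣ C 2) (+-identityʳ ∣ F ∣)) (sym ([1+n]C2 ∣ F ∣))
  add false = refl

∑-if≟ : ∀ {m} (v : Fin (suc m)) A B → ∑ (λ j → if does (j ≟ v) then A else B) ≡ A + m * B
∑-if≟ {m}     zero    A B = cong (A +_) (∑-const m B)
∑-if≟ {suc m} (suc v) A B = trans (cong (B +_) (∑-if≟ v A B)) (swap B A (m * B))
  where
  swap : ∀ B A C → B + (A + C) ≡ A + (B + C)
  swap = solve-∀

pairSum-star : ∀ {m} (v : Fin (suc m)) A B →
  pairSum (λ i j → if does (i ≟ v) ∨ does (j ≟ v) then A else B) ≡ m * A + (m C 2) * B
pairSum-star {m} zero A B = cong₂ _+_ (∑-const m A) (pairSum-const m B)
pairSum-star {suc m} (suc v) A B = begin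
  ∑ (λ j → if does (suc j ≟ suc v) then A else B)
    + pairSum (λ i j → if does (suc i ≟ suc v) ∨ does (suc j ≟ suc v) then A else B)
    ≡⟨ cong₂ _+_ (∑-if≟ v A B) (pairSum-star v A B) ⟩
  (A + m * B) + (m * A + (m C 2) * B)
    ≡⟨ regroup A B m (m C 2) ⟩
  (A + m * A) + (m + m C 2) * B
    ≡⟨ cong (λ c → A + m * A + c * B) ([1+n]C2 m) ⟨
  suc m * A + (suc m C 2) * B ∎
  where
  open ≡-Reasoning
  regroup : ∀ A B m c → (A + m * B) + (m * A + c * B) ≡ (A + m * A) + (m + c) * B
  regroup = solve-∀

module _ {A B : Set} where

  sum-map-concatMap : ∀ (g : B → ℕ) (h : A → List B) xs →
    sum (map g (concatMap h xs)) ≡ sum (map (λ x → sum (map g (h x))) xs)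
  sum-map-concatMap g h []       = refl
  sum-map-concatMap g h (x ∷ xs) = begin
    sum (map g (h x ++ concatMap h xs))
      ≡⟨ cong sum (map-++ g (h x) _) ⟩
    sum (map g (h x) ++ map g (concatMap h xs))
      ≡⟨ sum-++ (map g (h x)) _ ⟩
    sum (map g (h x)) + sum (map g (concatMap h xs))
      ≡⟨ cong (sum (map g (h x)) +_) (sum-map-concatMap g h xs) ⟩
    sum (map (λ x → sum (map g (h x))) (x ∷ xs)) ∎
    where open ≡-Reasoning

  sum-map-map : ∀ (g : B → ℕ) (h : A → B) xs → sum (map g (map h xs)) ≡ sum (map (g ∘ h) xs)
  sum-map-map g h xs = cong sum (sym (map-∘ xs))

sum-map-filter : ∀ {A : Set} {P : A → Set} (P? : Decidable P) (f : A → ℕ) xs →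
  sum (map f (filter P? xs)) ≡ sum (map (λ x → if does (P? x) then f x else 0) xs)
sum-map-filter P? f []       = refl
sum-map-filter P? f (x ∷ xs) with does (P? x)
... | true  = cong (f x +_) (sum-map-filter P? f xs)
... | false = sum-map-filter P? f xs

sum-map-allFin : ∀ {n} (f : Fin n → ℕ) → sum (map f (allFin n)) ≡ ∑ f
sum-map-allFin f = go f id
  where
  go : ∀ {n} {A : Set} (f : A → ℕ) (g : Fin n → A) → sum (map f (List.tabulate g)) ≡ ∑ (f ∘ g)
  go {zero}  f g = refl
  go {suc n} f g = cong (f (g zero) +_) (go f (g ∘ suc))

∑∑-upper≡pairSum : ∀ {n} (f : Fin n → Fin n → ℕ) →
  ∑ (λ i → ∑ (λ j → if does (i F.<? j) then f i j else 0)) ≡ pairSum f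
∑∑-upper≡pairSum {zero}  f = refl
∑∑-upper≡pairSum {suc n} f =
  cong (∑ (λ j → f zero (suc j)) +_) (∑∑-upper≡pairSum (λ i j → f (suc i) (suc j)))

sum-pairs : ∀ {n} (g : Fin n × Fin n → ℕ) → sum (map g (pairs n)) ≡ pairSum (λ i j → g (i , j))
sum-pairs {n} g = begin
  sum (map g (pairs n))
    ≡⟨ sum-map-concatMap g row (allFin n) ⟩
  sum (map (λ i → sum (map g (row i))) (allFin n))
    ≡⟨ sum-map-allFin (λ i → sum (map g (row i))) ⟩
  ∑ (λ i → sum (map g (row i)))
    ≡⟨ sum-cong-≗ (λ i → trans (sum-map-map g (i ,_) (filter (i F.<?_) (allFin n)))
                               (sum-map-filter (i F.<?_) (λ j → g (i , j)) (allFin n))) ⟩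
  ∑ (λ i → sum (map (λ j → if does (i F.<? j) then g (i , j) else 0) (allFin n)))
    ≡⟨ sum-cong-≗ (λ i → sum-map-allFin (λ j → if does (i F.<? j) then g (i , j) else 0)) ⟩
  ∑ (λ i → ∑ (λ j → if does (i F.<? j) then g (i , j) else 0))
    ≡⟨ ∑∑-upper≡pairSum (λ i j → g (i , j)) ⟩
  pairSum (λ i j → g (i , j)) ∎
  where
  open ≡-Reasoning
  row : Fin n → List (Fin n × Fin n)
  row i = map (i ,_) (filter (i F.<?_) (allFin n))

co≡pairSum : ∀ {n} p (H : Family n) → co p H ≡ pairSum (λ i j → codeg H i j ^ p)
co≡pairSum p H = sum-pairs (λ { (i , j) → codeg H i j ^ p })

-- Codegrees

module _ {n : ℕ} where

  _⊆ᶠ_ : Family n → Family n → Set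
  H ⊆ᶠ G = ∀ {F} → H F ≡ true → G F ≡ true

  ∧-⊆ᶠ : ∀ {H G : Family n} {Q : Subset n → Bool} → H ⊆ᶠ G →
    ∀ F → H F ∧ Q F ≡ true → G F ∧ Q F ≡ true
  ∧-⊆ᶠ {H} H⊆G F HQ with H F in HF
  ... | true rewrite H⊆G HF = HQ

  codeg≡count : ∀ (H : Family n) i j →
    codeg H i j ≡ countSubsets (λ F → H F ∧ (lookup F i ∧ lookup F j))
  codeg≡count H i j = length-filter≡count (λ F → H F ∧ (lookup F i ∧ lookup F j)) (allSubsets n)

  codeg-mono : ∀ {H G : Family n} → H ⊆ᶠ G → ∀ i j → codeg H i j ≤ codeg G i j
  codeg-mono {H} {G} H⊆G i j = begin
    codeg H i j
      ≡⟨ codeg≡count H i j ⟩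
    countSubsets (λ F → H F ∧ (lookup F i ∧ lookup F j))
      ≤⟨ count-mono (∧-⊆ᶠ H⊆G) (allSubsets n) ⟩
    countSubsets (λ F → G F ∧ (lookup F i ∧ lookup F j))
      ≡⟨ codeg≡count G i j ⟨
    codeg G i j ∎
    where open ≤-Reasoning

  co-mono : ∀ p {H G : Family n} → H ⊆ᶠ G → co p H ≤ co p G
  co-mono p {H} {G} H⊆G = begin
    co p H                             ≡⟨ co≡pairSum p H ⟩
    pairSum (λ i j → codeg H i j ^ p)  ≤⟨ pairSum-mono-≤ (λ i j _ → ^-monoˡ-≤ p (codeg-mono H⊆G i j)) ⟩
    pairSum (λ i j → codeg G i j ^ p)  ≡⟨ co≡pairSum p G ⟨
    co p G                             ∎
    where open ≤-Reasoning

  co-cong : ∀ p {H G : Family n} → (∀ F → H F ≡ G F) → co p H ≡ co p G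
  co-cong p H≗G = ≤-antisym (co-mono p (λ {F} HF → trans (sym (H≗G F)) HF))
                            (co-mono p (λ {F} GF → trans (H≗G F) GF))

  -- F contains a pair i < j, and its codegree drops from G to H.
  co-mono-< : ∀ p {H G : Family n} → 1 ≤ p → H ⊆ᶠ G →
    ∀ {F} → G F ≡ true → H F ≡ false → 2 ≤ ∣ F ∣ → co p H < co p G
  co-mono-< (suc p) {H} {G} _ H⊆G {F} GF HF 2≤∣F∣
    with pairSum-pos (λ i j → 𝟙 (lookup F i) * 𝟙 (lookup F j))
                     (subst (0 <_) (sym (pairSum-inside F)) (0<C2 2≤∣F∣))
  ... | i , j , i<j , Fij>0 = begin-strict
    co (suc p) H                           ≡⟨ co≡pairSum (suc p) H ⟩
    pairSum (λ i j → codeg H i j ^ suc p)  <⟨ pairSum-mono-< (λ i j _ → ^-monoˡ-≤ (suc p) (codeg-mono H⊆G i j))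
                                                             i<j (^-monoˡ-< (suc p) codeg-drops) ⟩
    pairSum (λ i j → codeg G i j ^ suc p)  ≡⟨ co≡pairSum (suc p) G ⟨
    co (suc p) G                           ∎
    where
    open ≤-Reasoning
    Fi×Fj : lookup F i ≡ true × lookup F j ≡ true
    Fi×Fj = 𝟙*𝟙>0 Fij>0
    codeg-drops : codeg H i j < codeg G i j
    codeg-drops = begin-strict
      codeg H i j
        ≡⟨ codeg≡count H i j ⟩
      countSubsets (λ F → H F ∧ (lookup F i ∧ lookup F j))
        <⟨ count-mono-< (∧-⊆ᶠ H⊆G) (∈-allSubsets F) (cong₂ _∧_ GF (cong₂ _∧_ (proj₁ Fi×Fj) (proj₂ Fi×Fj)))
                        (cong (_∧ (lookup F i ∧ lookup F j)) HF) ⟩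
      countSubsets (λ F → G F ∧ (lookup F i ∧ lookup F j))
        ≡⟨ codeg≡count G i j ⟨
      codeg G i j ∎

co-rigid : ∀ {n} p {H G : Family n} → 1 ≤ p → (∀ F → G F ≡ true → 2 ≤ ∣ F ∣) →
  H ⊆ᶠ G → co p H ≡ co p G → ∀ F → H F ≡ G F
co-rigid {n} p {H} {G} 1≤p large H⊆G co≡ F with H F in HF | G F in GF
... | true  | _     = trans (sym (H⊆G HF)) GF
... | false | false = refl
... | false | true  = contradiction co≡ (<⇒≢ (co-mono-< p {H} {G} 1≤p H⊆G {F} GF HF (large F GF)))

module _ {n : ℕ} where

  Intersecting : Family n → Set
  Intersecting H =
    ∀ {F G} → H F ≡ true → H G ≡ true → ∃ λ w → lookup F w ≡ true × lookup G w ≡ true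

  ν≡1⇒member : ∀ {H : Family n} → MatchingNumberIs H 1 → ∃ λ F → H F ≡ true
  ν≡1⇒member ((F ∷ [] , (HF ∷ [] , _) , _) , _) = F , HF

  ν≡1⇒intersecting : ∀ {H : Family n} → Is3Uniform H → MatchingNumberIs H 1 → Intersecting H
  ν≡1⇒intersecting {H} uniform (_ , maximal) {F} {G} HF HG
    with any? (λ w → (lookup F w Bool.≟ true) ×-dec (lookup G w Bool.≟ true))
  ... | yes common = common
  ... | no  none   = contradiction (maximal (F ∷ G ∷ []) matching) (<⇒≱ ≤-refl)
    where
    disjoint : F ∩ G ≡ ⊥
    disjoint = Empty-unique λ (w , w∈F∩G) →
      let w∈F , w∈G = x∈p∩q⁻ F G w∈F∩G in none (w , []=⇒lookup w∈F , []=⇒lookup w∈G)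
    F≢G : F ≢ G
    F≢G refl = 0≢1+n (begin
      0         ≡⟨ ∣⊥∣≡0 n ⟨
      ∣ ⊥ {n} ∣ ≡⟨ cong ∣_∣ disjoint ⟨
      ∣ F ∩ F ∣ ≡⟨ cong ∣_∣ (∩-idem F) ⟩
      ∣ F ∣     ≡⟨ uniform F HF ⟩
      3         ∎)
      where open ≡-Reasoning
    matching : IsMatching H (F ∷ G ∷ [])
    matching = (HF ∷ HG ∷ []) , ((F≢G ∷ []) ∷ [] ∷ []) , ((disjoint ∷ []) ∷ [] ∷ [])

  Covers : Family n → Fin n → Set
  Covers H v = ∀ {F} → H F ≡ true → lookup F v ≡ true

  Covers₂ : Family n → Fin n → Fin n → Set
  Covers₂ H x y = ∀ {F} → H F ≡ true → lookup F x ∨ lookup F y ≡ true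

  Avoidable : Family n → Fin n → Set
  Avoidable H v = ∃ λ G → H G ≡ true × lookup G v ≡ false

  Avoidable₂ : Family n → Fin n → Fin n → Set
  Avoidable₂ H x y = ∃ λ G → H G ≡ true × lookup G x ≡ false × lookup G y ≡ false

  avoidable? : ∀ (H : Family n) → Decidable (Avoidable H)
  avoidable? H v = anySubset? (λ G → (H G Bool.≟ true) ×-dec (lookup G v Bool.≟ false))

  avoidable₂? : ∀ (H : Family n) x y → Dec (x ≡ y ⊎ Avoidable₂ H x y)
  avoidable₂? H x y = (x ≟ y) ⊎-dec anySubset? λ G →
    (H G Bool.≟ true) ×-dec ((lookup G x Bool.≟ false) ×-dec (lookup G y Bool.≟ false))

  covered-or-avoidable : ∀ (H : Family n) → (∃ λ v → Covers H v) ⊎ (∀ v → Avoidable H v)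
  covered-or-avoidable H with all? (avoidable? H)
  ... | yes avoidable = inj₂ avoidable
  ... | no  ¬avoidable with ¬∀⟶∃¬ n (Avoidable H) (avoidable? H) ¬avoidable
  ...   | v , ¬avoidable-v = inj₁ (v , covers)
    where
    covers : Covers H v
    covers {F} HF with lookup F v in Fv
    ... | true  = refl
    ... | false = contradiction (F , HF , Fv) ¬avoidable-v

  pair-covered-or-avoidable : ∀ (H : Family n) →
    (∃ λ x → ∃ λ y → Covers₂ H x y) ⊎ (∀ x y → x ≢ y → Avoidable₂ H x y)
  pair-covered-or-avoidable H with all? (λ x → all? (avoidable₂? H x))
  ... | yes avoidable = inj₂ λ x y x≢y → [ flip contradiction x≢y , id ]′ (avoidable x y)
  ... | no  ¬avoidable with ¬∀⟶∃¬ n _ (λ x → all? (avoidable₂? H x)) ¬avoidable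
  ...   | x , ¬avoidable-x with ¬∀⟶∃¬ n _ (avoidable₂? H x) ¬avoidable-x
  ...     | y , ¬avoidable-xy = inj₁ (x , y , covers)
    where
    covers : Covers₂ H x y
    covers {F} HF with lookup F x in Fx | lookup F y in Fy
    ... | true  | _     = refl
    ... | false | true  = refl
    ... | false | false = contradiction (inj₂ (F , HF , Fx , Fy)) ¬avoidable-xy

lookup-≢ : ∀ {n} (G : Subset n) {i g} → lookup G i ≡ false → lookup G g ≡ true → i ≢ g
lookup-≢ G Gi Gg refl with () ← trans (sym Gi) Gg

degree : ∀ {n} → Family n → Fin n → ℕ
degree H v = countSubsets (λ F → H F ∧ lookup F v)

module _ {n : ℕ} {H : Family n} (uniform : Is3Uniform H) where

  ⊆ᶠ3-sets : H ⊆ᶠ (λ F → ∣ F ∣ ≡ᵇ 3)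
  ⊆ᶠ3-sets {F} HF rewrite uniform F HF = refl

  codeg≤n∸2 : ∀ {i j} → i ≢ j → codeg H i j ≤ n ∸ 2
  codeg≤n∸2 {i} {j} i≢j = begin
    codeg H i j
      ≡⟨ codeg≡count H i j ⟩
    countSubsets (λ F → H F ∧ (lookup F i ∧ lookup F j))
      ≤⟨ count-mono (∧-⊆ᶠ ⊆ᶠ3-sets) (allSubsets n) ⟩
    countSubsets (λ F → (∣ F ∣ ≡ᵇ 3) ∧ (lookup F i ∧ lookup F j))
      ≡⟨ countSubsets-3⊇pair i≢j ⟩
    n ∸ 2 ∎
    where open ≤-Reasoning

  through₃ : Fin n → Fin n → Fin n → Subset n → Bool
  through₃ i j g F = H F ∧ (lookup F i ∧ (lookup F j ∧ lookup F g))

  countSubsets-through₃≤1 : ∀ {i j g} → i ≢ j → i ≢ g → j ≢ g → countSubsets (through₃ i j g) ≤ 1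
  countSubsets-through₃≤1 i≢j i≢g j≢g = ≤-trans (count-mono (∧-⊆ᶠ ⊆ᶠ3-sets) (allSubsets n))
                                                 (≤-reflexive (countSubsets-3⊇triple i≢j i≢g j≢g))

  pairSum-codeg : pairSum (codeg H) ≡ 3 * countSubsets H
  pairSum-codeg = trans (pairSum-cong (λ i j _ → codeg≡count H i j)) (go (allSubsets n))
    where
    one : ∀ F → pairSum (λ i j → 𝟙 (H F ∧ (lookup F i ∧ lookup F j))) ≡ 3 * 𝟙 (H F)
    one F with H F in HF
    ... | false = trans (pairSum-const n 0) (*-zeroʳ (n C 2))
    ... | true  = begin
      pairSum (λ i j → 𝟙 (lookup F i ∧ lookup F j))      ≡⟨ pairSum-cong (λ i j _ → 𝟙-∧ (lookup F i) _) ⟩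
      pairSum (λ i j → 𝟙 (lookup F i) * 𝟙 (lookup F j))  ≡⟨ pairSum-inside F ⟩
      ∣ F ∣ C 2                                          ≡⟨ cong (_C 2) (uniform F HF) ⟩
      3                                                  ∎
      where open ≡-Reasoning
    through : Fin n → Fin n → Subset n → Bool
    through i j F = H F ∧ (lookup F i ∧ lookup F j)
    go : ∀ Fs → pairSum (λ i j → count (through i j) Fs) ≡ 3 * count H Fs
    go []       = trans (pairSum-const n 0) (*-zeroʳ (n C 2))
    go (F ∷ Fs) = begin
      pairSum (λ i j → 𝟙 (through i j F) + count (through i j) Fs)
        ≡⟨ pairSum-+ (λ i j → 𝟙 (through i j F)) _ ⟩
      pairSum (λ i j → 𝟙 (through i j F)) + pairSum (λ i j → count (through i j) Fs)
        ≡⟨ cong₂ _+_ (one F) (go Fs) ⟩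
      3 * 𝟙 (H F) + 3 * count H Fs
        ≡⟨ *-distribˡ-+ 3 (𝟙 (H F)) (count H Fs) ⟨
      3 * count H (F ∷ Fs) ∎
      where open ≡-Reasoning

  module _ (intersecting : Intersecting H) where

    codeg≤3 : ∀ {G i j} → H G ≡ true → lookup G i ≡ false → lookup G j ≡ false → i ≢ j →
      codeg H i j ≤ 3
    codeg≤3 {G} {i} {j} HG Gi Gj i≢j = begin
      codeg H i j
        ≡⟨ codeg≡count H i j ⟩
      countSubsets (λ F → H F ∧ (lookup F i ∧ lookup F j))
        ≤⟨ count-≤-cover G (through₃ i j) (allSubsets n) meets-G at-most-one ⟩
      1 * ∣ G ∣
        ≡⟨ trans (*-identityˡ ∣ G ∣) (uniform G HG) ⟩
      3 ∎
      where
      open ≤-Reasoning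
      meets-G : ∀ F → H F ∧ (lookup F i ∧ lookup F j) ≡ true →
        ∃ λ g → lookup G g ≡ true × through₃ i j g F ≡ true
      meets-G F HFij with H F in HF | lookup F i in Fi | lookup F j in Fj
      ... | true | true | true with intersecting HF HG
      ...   | g , Fg , Gg = g , Gg , Fg
      at-most-one : ∀ g → lookup G g ≡ true → countSubsets (through₃ i j g) ≤ 1
      at-most-one g Gg = countSubsets-through₃≤1 i≢j (lookup-≢ G Gi Gg) (lookup-≢ G Gj Gg)

    codeg≤2 : ∀ {x y i j} → Covers₂ H x y → i ≢ x → i ≢ y → j ≢ x → j ≢ y → i ≢ j → codeg H i j ≤ 2
    codeg≤2 {x} {y} {i} {j} covers i≢x i≢y j≢x j≢y i≢j = begin
      codeg H i j
        ≡⟨ codeg≡count H i j ⟩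
      countSubsets (λ F → H F ∧ (lookup F i ∧ lookup F j))
        ≤⟨ count-union through-x-or-y (allSubsets n) ⟩
      countSubsets (through₃ i j x) + countSubsets (through₃ i j y)
        ≤⟨ +-mono-≤ (countSubsets-through₃≤1 i≢j i≢x j≢x) (countSubsets-through₃≤1 i≢j i≢y j≢y) ⟩
      2 ∎
      where
      open ≤-Reasoning
      through-x-or-y : ∀ F → H F ∧ (lookup F i ∧ lookup F j) ≡ true →
        through₃ i j x F ≡ true ⊎ through₃ i j y F ≡ true
      through-x-or-y F HFij with H F in HF | lookup F i in Fi | lookup F j in Fj
      ... | true | true | true with lookup F x in Fx | covers HF
      ...   | true  | _  = inj₁ refl
      ...   | false | Fy = inj₂ Fy

    degree≤*3 : ∀ {G v c} → H G ≡ true → lookup G v ≡ false →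
      (∀ g → lookup G g ≡ true → codeg H v g ≤ c) → degree H v ≤ c * 3
    degree≤*3 {G} {v} {c} HG Gv codeg≤c = begin
      degree H v
        ≤⟨ count-≤-cover G (λ g F → H F ∧ (lookup F v ∧ lookup F g)) (allSubsets n) meets-G
                         (λ g Gg → ≤-trans (≤-reflexive (sym (codeg≡count H v g))) (codeg≤c g Gg)) ⟩
      c * ∣ G ∣
        ≡⟨ cong (c *_) (uniform G HG) ⟩
      c * 3 ∎
      where
      open ≤-Reasoning
      meets-G : ∀ F → H F ∧ lookup F v ≡ true →
        ∃ λ g → lookup G g ≡ true × H F ∧ (lookup F v ∧ lookup F g) ≡ true
      meets-G F HFv with H F in HF | lookup F v in Fv
      ... | true | true with intersecting HF HG
      ...   | g , Fg , Gg = g , Gg , Fg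

    size≤*3 : ∀ {F₀ c} → H F₀ ≡ true → (∀ a → lookup F₀ a ≡ true → degree H a ≤ c) →
      countSubsets H ≤ c * 3
    size≤*3 {F₀} {c} HF₀ degree≤c = begin
      countSubsets H  ≤⟨ count-≤-cover F₀ (λ a F → H F ∧ lookup F a) (allSubsets n) meets-F₀ degree≤c ⟩
      c * ∣ F₀ ∣      ≡⟨ cong (c *_) (uniform F₀ HF₀) ⟩
      c * 3           ∎
      where
      open ≤-Reasoning
      meets-F₀ : ∀ F → H F ≡ true → ∃ λ a → lookup F₀ a ≡ true × H F ∧ lookup F a ≡ true
      meets-F₀ F HF with intersecting HF HF₀
      ... | a , Fa , F₀a rewrite HF = a , F₀a , Fa

-- Stars

starAt : ∀ {n} → Fin n → Family n
starAt v F = lookup F v ∧ (∣ F ∣ ≡ᵇ 3)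

star≗starAt-zero : ∀ {m} (F : Subset (suc m)) → star F ≡ starAt zero F
star≗starAt-zero (true  ∷ F) = refl
star≗starAt-zero (false ∷ F) = refl

module _ {n : ℕ} where

  starAt-uniform : ∀ (v : Fin n) → Is3Uniform (starAt v)
  starAt-uniform v F vF with lookup F v
  ... | true = ≡ᵇ⇒≡ ∣ F ∣ 3 (subst T (sym vF) _)

  starAt-⊇ : ∀ {H : Family n} {v} → Is3Uniform H → Covers H v → H ⊆ᶠ starAt v
  starAt-⊇ {v = v} uniform covers {F} HF rewrite covers HF = ⊆ᶠ3-sets uniform HF

  codeg-starAt : ∀ (v : Fin n) {i j} → i ≢ j →
    codeg (starAt v) i j ≡ (if does (i ≟ v) ∨ does (j ≟ v) then n ∸ 2 else 1)
  codeg-starAt v {i} {j} i≢j = trans (codeg≡count (starAt v) i j) (by-cases (i ≟ v) (j ≟ v))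
    where
    absorbˡ : ∀ a s b → (a ∧ s) ∧ (a ∧ b) ≡ s ∧ (a ∧ b)
    absorbˡ true  s b = refl
    absorbˡ false s b = sym (∧-zeroʳ s)
    absorbʳ : ∀ b s a → (b ∧ s) ∧ (a ∧ b) ≡ s ∧ (a ∧ b)
    absorbʳ true  s     a     = refl
    absorbʳ false false a     = refl
    absorbʳ false true  false = refl
    absorbʳ false true  true  = refl
    rotate : ∀ c s a b → (c ∧ s) ∧ (a ∧ b) ≡ s ∧ (a ∧ (b ∧ c))
    rotate true  s     a     true  = refl
    rotate true  s     a     false = refl
    rotate false false a     b     = refl
    rotate false true  false b     = refl
    rotate false true  true  true  = refl
    rotate false true  true  false = refl
    by-cases : (i? : Dec (i ≡ v)) (j? : Dec (j ≡ v)) →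
      countSubsets (λ F → starAt v F ∧ (lookup F i ∧ lookup F j))
        ≡ (if does i? ∨ does j? then n ∸ 2 else 1)
    by-cases (yes refl) _ = trans (count-cong (λ F → absorbˡ (lookup F i) _ _) (allSubsets n))
                                  (countSubsets-3⊇pair i≢j)
    by-cases (no i≢v) (yes refl) = trans (count-cong (λ F → absorbʳ (lookup F j) _ _) (allSubsets n))
                                         (countSubsets-3⊇pair i≢j)
    by-cases (no i≢v) (no j≢v) =
      trans (count-cong (λ F → rotate (lookup F v) (∣ F ∣ ≡ᵇ 3) (lookup F i) (lookup F j)) (allSubsets n))
            (countSubsets-3⊇triple i≢j i≢v j≢v)

coStar : ℕ → ℕ → ℕ
coStar m p = m * (m ∸ 1) ^ p + m C 2

co-starAt : ∀ {m} p (v : Fin (suc m)) → co p (starAt v) ≡ coStar m p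
co-starAt {m} p v = begin
  co p (starAt v)
    ≡⟨ co≡pairSum p (starAt v) ⟩
  pairSum (λ i j → codeg (starAt v) i j ^ p)
    ≡⟨ pairSum-cong (λ i j i<j → trans (cong (_^ p) (codeg-starAt v (<⇒≢ᶠ i<j)))
                                       (if-float (_^ p) (does (i ≟ v) ∨ does (j ≟ v)))) ⟩
  pairSum (λ i j → if does (i ≟ v) ∨ does (j ≟ v) then (m ∸ 1) ^ p else 1 ^ p)
    ≡⟨ pairSum-star v ((m ∸ 1) ^ p) (1 ^ p) ⟩
  m * (m ∸ 1) ^ p + (m C 2) * 1 ^ p
    ≡⟨ cong (λ c → m * (m ∸ 1) ^ p + (m C 2) * c) (^-zeroˡ p) ⟩
  m * (m ∸ 1) ^ p + (m C 2) * 1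
    ≡⟨ cong (m * (m ∸ 1) ^ p +_) (*-identityʳ (m C 2)) ⟩
  coStar m p ∎
  where open ≡-Reasoning

co-star : ∀ {m} p → co p (star {suc m}) ≡ coStar m p
co-star {m} p = trans (co-cong {suc m} p star≗starAt-zero) (co-starAt {m} p zero)

∣image∣ : ∀ {n} (σ : Fin n ↔ Fin n) (F : Subset n) → ∣ image σ F ∣ ≡ ∣ F ∣
∣image∣ σ F = begin
  ∣ image σ F ∣                      ≡⟨ ∣∣≡∑𝟙 (image σ F) ⟩
  ∑ (𝟙 ∘ lookup (image σ F))         ≡⟨ sum-cong-≗ (cong 𝟙 ∘ lookup∘tabulate (lookup F ∘ Inverse.from σ)) ⟩
  ∑ (𝟙 ∘ lookup F ∘ Inverse.from σ)  ≡⟨ sum-permute (𝟙 ∘ lookup F) (Perm.flip σ) ⟨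
  ∑ (𝟙 ∘ lookup F)                   ≡⟨ ∣∣≡∑𝟙 F ⟨
  ∣ F ∣                              ∎
  where open ≡-Reasoning

star∘image : ∀ {m} (σ : Fin (suc m) ↔ Fin (suc m)) F →
  star (image σ F) ≡ starAt (Inverse.from σ zero) F
star∘image σ F = begin
  star (image σ F)
    ≡⟨ star≗starAt-zero (image σ F) ⟩
  lookup (image σ F) zero ∧ (∣ image σ F ∣ ≡ᵇ 3)
    ≡⟨ cong₂ (λ b m → b ∧ (m ≡ᵇ 3)) (lookup∘tabulate (lookup F ∘ Inverse.from σ) zero) (∣image∣ σ F) ⟩
  lookup F (Inverse.from σ zero) ∧ (∣ F ∣ ≡ᵇ 3) ∎
  where open ≡-Reasoning

Iso⇒co≡ : ∀ {m} p {H : Family (suc m)} → Iso H star → co p H ≡ co p (star {suc m})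
Iso⇒co≡ {m} p {H} (σ , H≗star∘σ) = begin
  co p H
    ≡⟨ co-cong p (λ F → trans (H≗star∘σ F) (star∘image σ F)) ⟩
  co p (starAt (Inverse.from σ zero))  ≡⟨ co-starAt p (Inverse.from σ zero) ⟩
  coStar m p                           ≡⟨ co-star {m} p ⟨
  co p (star {suc m})                  ∎
  where open ≡-Reasoning

≗-Iso : ∀ {n} {H G K : Family n} → (∀ F → H F ≡ G F) → Iso G K → Iso H K
≗-Iso H≗G (σ , G≗K∘σ) = σ , λ F → trans (H≗G F) (G≗K∘σ F)

starAt-Iso : ∀ {m} (v : Fin (suc m)) → Iso (starAt v) star
starAt-Iso v = transpose zero v , λ F → sym (trans (star∘image (transpose zero v) F)
                                                   (cong (λ w → starAt w F) (transpose-zero v)))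
  where
  transpose-zero : ∀ {m} (v : Fin (suc m)) → Inverse.from (transpose zero v) zero ≡ v
  transpose-zero v with zero ≟ v
  ... | yes zero≡v = zero≡v
  ... | no  _      = refl

module Covered {m} {H : Family (suc m)} {v} (uniform : Is3Uniform H) (covers : Covers H v) where

  co-starAt≡co-star : ∀ p → co p (starAt v) ≡ co p (star {suc m})
  co-starAt≡co-star p = trans (co-starAt p v) (sym (co-star {m} p))

  co≤co-star : ∀ p → co p H ≤ co p (star {suc m})
  co≤co-star p = ≤-trans (co-mono {suc m} p {H} {starAt v} (starAt-⊇ uniform covers))
                         (≤-reflexive (co-starAt≡co-star p))

  co≡co-star⇒Iso : ∀ p → 1 ≤ p → co p H ≡ co p (star {suc m}) → Iso H (star {suc m})
  co≡co-star⇒Iso p 1≤p co≡ = ≗-Iso {K = star} H≗starAt (starAt-Iso {m} v)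
    where
    H≗starAt : ∀ F → H F ≡ starAt v F
    H≗starAt = co-rigid {suc m} p {H} {starAt v} 1≤p
                 (λ F vF → subst (2 ≤_) (sym (starAt-uniform v F vF)) (s≤s (s≤s z≤n)))
                 (starAt-⊇ uniform covers) (trans co≡ (sym (co-starAt≡co-star p)))

-- Families without a covering vertex

module Uncovered {n : ℕ} {H : Family n} (uniform : Is3Uniform H) (intersecting : Intersecting H)
                 (avoidable : ∀ v → Avoidable H v) where

  avoider : Fin n → Subset n
  avoider v = proj₁ (avoidable v)

  avoider-∈ : ∀ v → H (avoider v) ≡ true
  avoider-∈ v = proj₁ (proj₂ (avoidable v))

  avoider-∌ : ∀ v → lookup (avoider v) v ≡ false
  avoider-∌ v = proj₂ (proj₂ (avoidable v))

  heavy : Fin n → Fin n → ℕ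
  heavy i j = 𝟙 (does (4 ≤? codeg H i j))

  heavy≡1 : ∀ {i j} → 4 ≤ codeg H i j → heavy i j ≡ 1
  heavy≡1 {i} {j} = cong 𝟙 ∘ dec-true (4 ≤? codeg H i j)

  heavy≡0 : ∀ {i j} → ¬ 4 ≤ codeg H i j → heavy i j ≡ 0
  heavy≡0 {i} {j} = cong 𝟙 ∘ dec-false (4 ≤? codeg H i j)

  meets-heavy : ∀ {G i j} → H G ≡ true → i ≢ j → 4 ≤ codeg H i j → lookup G i ∨ lookup G j ≡ true
  meets-heavy {G} {i} {j} HG i≢j 4≤codeg with lookup G i in Gi | lookup G j in Gj
  ... | true  | _     = refl
  ... | false | true  = refl
  ... | false | false = contradiction (codeg≤3 uniform intersecting HG Gi Gj i≢j) (<⇒≱ 4≤codeg)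

  heavy-through : ∀ {v i j} → i ≢ j → 4 ≤ codeg H i j → i ≡ v ⊎ j ≡ v →
    1 ≤ pairsThrough v (avoider v) i j
  heavy-through {v} {i} {j} i≢j 4≤codeg (inj₁ refl) = pairsThrough-hit {v = v} {G = G} (inj₁ (refl , Gj))
    where
    G = avoider v
    Gj : lookup G j ≡ true
    Gj = subst (λ b → b ∨ lookup G j ≡ true) (avoider-∌ v) (meets-heavy (avoider-∈ v) i≢j 4≤codeg)
  heavy-through {v} {i} {j} i≢j 4≤codeg (inj₂ refl) = pairsThrough-hit {v = v} {G = G} (inj₂ (refl , Gi))
    where
    G = avoider v
    Gi : lookup G i ≡ true
    Gi = trans (sym (∨-identityʳ _))
               (subst (λ b → lookup G i ∨ b ≡ true) (avoider-∌ v) (meets-heavy (avoider-∈ v) i≢j 4≤codeg))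

  module UnavoidablePairs (avoidable₂ : ∀ x y → x ≢ y → Avoidable₂ H x y) where

    all-codeg≤3 : ∀ {i j} → i ≢ j → codeg H i j ≤ 3
    all-codeg≤3 {i} {j} i≢j with avoidable₂ i j i≢j
    ... | G , HG , Gi , Gj = codeg≤3 uniform intersecting HG Gi Gj i≢j

    pairSum-heavy≡0 : pairSum heavy ≡ 0
    pairSum-heavy≡0 = begin
      pairSum heavy           ≡⟨ pairSum-cong (λ i j i<j → heavy≡0 (<⇒≱ (s≤s (all-codeg≤3 (<⇒≢ᶠ i<j))))) ⟩
      pairSum {n} (λ _ _ → 0) ≡⟨ pairSum-const n 0 ⟩
      (n C 2) * 0             ≡⟨ *-zeroʳ (n C 2) ⟩
      0                       ∎
      where open ≡-Reasoning

    size≤27 : ∀ {F₀} → H F₀ ≡ true → countSubsets H ≤ 27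
    size≤27 HF₀ = size≤*3 uniform intersecting HF₀ λ a _ →
      degree≤*3 uniform intersecting (avoider-∈ a) (avoider-∌ a)
                (λ g Gg → all-codeg≤3 (lookup-≢ (avoider a) (avoider-∌ a) Gg))

  module CoveringPair {x y : Fin n} (covers : Covers₂ H x y) where

    avoider-y∋x : lookup (avoider y) x ≡ true
    avoider-y∋x with lookup (avoider y) x in Gx | covers (avoider-∈ y)
    ... | true  | _   = refl
    ... | false | Gy = contradiction (trans (sym (avoider-∌ y)) Gy) λ ()

    degree-x≤ : degree H x ≤ (n ∸ 2) * 3
    degree-x≤ = degree≤*3 uniform intersecting (avoider-∈ x) (avoider-∌ x)
                          (λ g Gg → codeg≤n∸2 uniform (lookup-≢ (avoider x) (avoider-∌ x) Gg))

    -- Members avoiding x contain y and meet the avoider of y outside x.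
    avoiding-x≤ : countSubsets (λ F → H F ∧ not (lookup F x)) ≤ (n ∸ 2) * 2
    avoiding-x≤ = begin
      countSubsets (λ F → H F ∧ not (lookup F x))
        ≤⟨ count-≤-cover (Gy - x) (λ g F → H F ∧ (lookup F y ∧ lookup F g)) (allSubsets n)
                         charge bound ⟩
      (n ∸ 2) * ∣ Gy - x ∣
        ≤⟨ *-monoʳ-≤ (n ∸ 2) (≤-pred ∣Gy-x∣<3) ⟩
      (n ∸ 2) * 2 ∎
      where
      open ≤-Reasoning
      Gy = avoider y
      ∣Gy-x∣<3 : ∣ Gy - x ∣ < 3
      ∣Gy-x∣<3 = subst (∣ Gy - x ∣ <_) (uniform Gy (avoider-∈ y))
                       (x∈p⇒∣p-x∣<∣p∣ (lookup⇒[]= x Gy avoider-y∋x))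
      charge : ∀ F → H F ∧ not (lookup F x) ≡ true →
        ∃ λ g → lookup (Gy - x) g ≡ true × H F ∧ (lookup F y ∧ lookup F g) ≡ true
      charge F HF¬x with H F in HF | lookup F x in Fx
      ... | true | false with intersecting HF (avoider-∈ y)
      ...   | g , Fg , Gyg =
        g , []=⇒lookup (x∈p∧x≢y⇒x∈p-y (lookup⇒[]= g Gy Gyg) (lookup-≢ F Fx Fg ∘ sym)) ,
        cong₂ _∧_ (subst (λ b → b ∨ lookup F y ≡ true) Fx (covers HF)) Fg
      bound : ∀ g → lookup (Gy - x) g ≡ true →
        countSubsets (λ F → H F ∧ (lookup F y ∧ lookup F g)) ≤ n ∸ 2
      bound g Gy-x∋g = ≤-trans (≤-reflexive (sym (codeg≡count H y g)))
                               (codeg≤n∸2 uniform (lookup-≢ Gy (avoider-∌ y) Gy∋g))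
        where
        Gy∋g = []=⇒lookup (p─q⊆p Gy ⁅ x ⁆ (lookup⇒[]= g (Gy - x) Gy-x∋g))

    size≤5*[n∸2] : countSubsets H ≤ 5 * (n ∸ 2)
    size≤5*[n∸2] = begin
      countSubsets H
        ≡⟨ count-split H (λ F → lookup F x) (allSubsets n) ⟩
      degree H x + countSubsets (λ F → H F ∧ not (lookup F x))
        ≤⟨ +-mono-≤ degree-x≤ avoiding-x≤ ⟩
      (n ∸ 2) * 3 + (n ∸ 2) * 2
        ≡⟨ *-distribˡ-+ (n ∸ 2) 3 2 ⟨
      (n ∸ 2) * 5
        ≡⟨ *-comm (n ∸ 2) 5 ⟩
      5 * (n ∸ 2) ∎
      where open ≤-Reasoning

    pairsThrough-x-or-y : Fin n → Fin n → ℕ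
    pairsThrough-x-or-y i j = pairsThrough x (avoider x) i j + pairsThrough y (avoider y) i j

    via-x : ∀ {i j} → 1 ≤ pairsThrough x (avoider x) i j → 1 ≤ pairsThrough-x-or-y i j
    via-x {i} {j} hit = ≤-trans hit (m≤m+n _ (pairsThrough y (avoider y) i j))

    via-y : ∀ {i j} → 1 ≤ pairsThrough y (avoider y) i j → 1 ≤ pairsThrough-x-or-y i j
    via-y {i} {j} hit = ≤-trans hit (m≤n+m _ (pairsThrough x (avoider x) i j))

    heavy-hits : ∀ {i j} → i ≢ j → 4 ≤ codeg H i j → 1 ≤ pairsThrough-x-or-y i j
    heavy-hits {i} {j} i≢j 4≤codeg with i ≟ x | j ≟ x | i ≟ y | j ≟ y
    ... | yes i≡x | _       | _       | _       = via-x (heavy-through i≢j 4≤codeg (inj₁ i≡x))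
    ... | no _    | yes j≡x | _       | _       = via-x (heavy-through i≢j 4≤codeg (inj₂ j≡x))
    ... | no _    | no _    | yes i≡y | _       = via-y (heavy-through i≢j 4≤codeg (inj₁ i≡y))
    ... | no _    | no _    | no _    | yes j≡y = via-y (heavy-through i≢j 4≤codeg (inj₂ j≡y))
    ... | no i≢x  | no j≢x  | no i≢y  | no j≢y  =
      contradiction (codeg≤2 uniform intersecting covers i≢x i≢y j≢x j≢y i≢j) (<⇒≱ (≤-trans (m≤m+n 3 1) 4≤codeg))

    heavy≤pairsThrough : ∀ i j → i F.< j → heavy i j ≤ pairsThrough-x-or-y i j
    heavy≤pairsThrough i j i<j with 4 ≤? codeg H i j
    ... | no  light   = ≤-trans (≤-reflexive (heavy≡0 light)) z≤n
    ... | yes 4≤codeg = ≤-trans (≤-reflexive (heavy≡1 4≤codeg)) (heavy-hits (<⇒≢ᶠ i<j) 4≤codeg)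

    pairSum-heavy≤6 : pairSum heavy ≤ 6
    pairSum-heavy≤6 = begin
      pairSum heavy
        ≤⟨ pairSum-mono-≤ heavy≤pairsThrough ⟩
      pairSum pairsThrough-x-or-y
        ≡⟨ pairSum-+ (pairsThrough x (avoider x)) (pairsThrough y (avoider y)) ⟩
      pairSum (pairsThrough x (avoider x)) + pairSum (pairsThrough y (avoider y))
        ≤⟨ +-mono-≤ (pairSum-pairsThrough x (avoider x)) (pairSum-pairsThrough y (avoider y)) ⟩
      ∣ avoider x ∣ + ∣ avoider y ∣
        ≡⟨ cong₂ _+_ (uniform (avoider x) (avoider-∈ x)) (uniform (avoider y) (avoider-∈ y)) ⟩
      6 ∎
      where open ≤-Reasoning

  heavy-and-size-bounds : 6 ≤ n ∸ 2 → ∀ {F₀} → H F₀ ≡ true →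
    pairSum heavy ≤ 6 × countSubsets H ≤ 5 * (n ∸ 2)
  heavy-and-size-bounds 6≤n∸2 HF₀ with pair-covered-or-avoidable H
  ... | inj₁ (x , y , covers) = CoveringPair.pairSum-heavy≤6 covers , CoveringPair.size≤5*[n∸2] covers
  ... | inj₂ avoidable₂ =
    ≤-trans (≤-reflexive (UnavoidablePairs.pairSum-heavy≡0 avoidable₂)) z≤n ,
    ≤-trans (UnavoidablePairs.size≤27 avoidable₂ HF₀) (≤-trans (m≤m+n 27 3) (*-monoʳ-≤ 5 6≤n∸2))

  codeg^≤ : ∀ q i j → i F.< j →
    codeg H i j ^ (2 + q) ≤ (n ∸ 2) ^ (2 + q) * heavy i j + 3 ^ (1 + q) * codeg H i j
  codeg^≤ q i j i<j with 4 ≤? codeg H i j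
  ... | yes 4≤codeg = begin
    codeg H i j ^ (2 + q)                      ≤⟨ ^-monoˡ-≤ (2 + q) (codeg≤n∸2 uniform (<⇒≢ᶠ i<j)) ⟩
    (n ∸ 2) ^ (2 + q)                          ≡⟨ *-identityʳ _ ⟨
    (n ∸ 2) ^ (2 + q) * 1                      ≡⟨ cong ((n ∸ 2) ^ (2 + q) *_) (heavy≡1 4≤codeg) ⟨
    (n ∸ 2) ^ (2 + q) * heavy i j              ≤⟨ m≤m+n _ _ ⟩
    (n ∸ 2) ^ (2 + q) * heavy i j + 3 ^ (1 + q) * codeg H i j ∎
    where open ≤-Reasoning
  ... | no light = begin
    codeg H i j * codeg H i j ^ (1 + q)        ≤⟨ *-monoʳ-≤ (codeg H i j) (^-monoˡ-≤ (1 + q) (≮⇒≥ light)) ⟩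
    codeg H i j * 3 ^ (1 + q)                  ≡⟨ *-comm (codeg H i j) _ ⟩
    3 ^ (1 + q) * codeg H i j                  ≤⟨ m≤n+m _ _ ⟩
    (n ∸ 2) ^ (2 + q) * heavy i j + 3 ^ (1 + q) * codeg H i j ∎
    where open ≤-Reasoning

  co-bound : ∀ q → co (2 + q) H ≤ (n ∸ 2) ^ (2 + q) * pairSum heavy + 3 ^ (1 + q) * pairSum (codeg H)
  co-bound q = begin
    co (2 + q) H
      ≡⟨ co≡pairSum (2 + q) H ⟩
    pairSum (λ i j → codeg H i j ^ (2 + q))
      ≤⟨ pairSum-mono-≤ (codeg^≤ q) ⟩
    pairSum (λ i j → (n ∸ 2) ^ (2 + q) * heavy i j + 3 ^ (1 + q) * codeg H i j)
      ≡⟨ pairSum-+ (λ i j → (n ∸ 2) ^ (2 + q) * heavy i j) (λ i j → 3 ^ (1 + q) * codeg H i j) ⟩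
    pairSum (λ i j → (n ∸ 2) ^ (2 + q) * heavy i j) + pairSum (λ i j → 3 ^ (1 + q) * codeg H i j)
      ≡⟨ cong₂ _+_ (pairSum-* ((n ∸ 2) ^ (2 + q)) heavy) (pairSum-* (3 ^ (1 + q)) (codeg H)) ⟩
    (n ∸ 2) ^ (2 + q) * pairSum heavy + 3 ^ (1 + q) * pairSum (codeg H) ∎
    where open ≤-Reasoning

  module _ (6≤n∸2 : 6 ≤ n ∸ 2) {F₀} (HF₀ : H F₀ ≡ true) where

    ∑codeg≤15[n∸2] : pairSum (codeg H) ≤ 3 * (5 * (n ∸ 2))
    ∑codeg≤15[n∸2] = ≤-trans (≤-reflexive (pairSum-codeg uniform))
                             (*-monoʳ-≤ 3 (proj₂ (heavy-and-size-bounds 6≤n∸2 HF₀)))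

    co₁≤ : co 1 H ≤ 3 * (5 * (n ∸ 2))
    co₁≤ = begin
      co 1 H                             ≡⟨ co≡pairSum 1 H ⟩
      pairSum (λ i j → codeg H i j ^ 1)  ≡⟨ pairSum-cong (λ i j _ → *-identityʳ (codeg H i j)) ⟩
      pairSum (codeg H)                  ≤⟨ ∑codeg≤15[n∸2] ⟩
      3 * (5 * (n ∸ 2))                  ∎
      where open ≤-Reasoning

    co₂₊≤ : ∀ q → co (2 + q) H ≤ (n ∸ 2) ^ (2 + q) * 6 + 3 ^ (1 + q) * (3 * (5 * (n ∸ 2)))
    co₂₊≤ q = ≤-trans (co-bound q)
      (+-mono-≤ (*-monoʳ-≤ ((n ∸ 2) ^ (2 + q)) (proj₁ (heavy-and-size-bounds 6≤n∸2 HF₀)))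
                (*-monoʳ-≤ (3 ^ (1 + q)) ∑codeg≤15[n∸2]))

<-by-slack : ∀ {a b} c → suc a + c ≡ b → a < b
<-by-slack {a} c eq = subst (suc a ≤_) eq (m≤m+n (suc a) c)

via-11+ : ∀ {k} (P : ℕ → Set) → 11 ≤ k → (∀ t → P (11 + t)) → P k
via-11+ {k} P 11≤k P₁₁₊ = subst P (m+[n∸m]≡n 11≤k) (P₁₁₊ (k ∸ 11))

uncoveredBound₁<coStar : ∀ {k} → 11 ≤ k → 3 * (5 * k) < coStar (suc k) 1
uncoveredBound₁<coStar {k} 11≤k = *-cancelˡ-< 2 _ _ (begin-strict
  2 * (3 * (5 * k))
    <⟨ via-11+ (λ k → 2 * (3 * (5 * k)) < 2 * (suc k * k) + suc k * k) 11≤k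
               (λ t → <-by-slack (65 + 39 * t + 3 * (t * t)) (slack t)) ⟩
  2 * (suc k * k) + suc k * k
    ≡⟨ cong₂ (λ a b → 2 * (suc k * a) + b) (*-identityʳ k) (2*[1+m]C2 k) ⟨
  2 * (suc k * k ^ 1) + 2 * (suc k C 2)
    ≡⟨ *-distribˡ-+ 2 (suc k * k ^ 1) _ ⟨
  2 * coStar (suc k) 1 ∎)
  where
  open ≤-Reasoning
  slack : ∀ t → suc (2 * (3 * (5 * (11 + t)))) + (65 + 39 * t + 3 * (t * t))
              ≡ 2 * (suc (11 + t) * (11 + t)) + suc (11 + t) * (11 + t)
  slack = solve-∀

uncoveredBound<coStar : ∀ {k} q → 11 ≤ k →
  k ^ (2 + q) * 6 + 3 ^ (1 + q) * (3 * (5 * k)) < coStar (suc k) (2 + q)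
uncoveredBound<coStar {k} q 11≤k = begin-strict
  k ^ (2 + q) * 6 + 3 * 3 ^ q * (3 * (5 * k))
    ≤⟨ +-monoʳ-≤ (k ^ (2 + q) * 6) (*-monoˡ-≤ (3 * (5 * k)) (*-monoʳ-≤ 3 (^-monoˡ-≤ q 3≤k))) ⟩
  k ^ (2 + q) * 6 + 3 * k ^ q * (3 * (5 * k))
    ≤⟨ via-11+ (λ k → k ^ (2 + q) * 6 + 3 * k ^ q * (3 * (5 * k)) ≤ suc k * k ^ (2 + q)) 11≤k
               (λ t → ≤-trans (m≤m+n _ _) (≤-reflexive (slack t ((11 + t) ^ q)))) ⟩
  suc k * k ^ (2 + q)
    <⟨ m<m+n (suc k * k ^ (2 + q)) (0<C2 (s≤s (≤-trans (s≤s z≤n) 11≤k))) ⟩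
  coStar (suc k) (2 + q) ∎
  where
  open ≤-Reasoning
  3≤k : 3 ≤ k
  3≤k = ≤-trans (m≤m+n 3 8) 11≤k
  slack : ∀ t K → (11 + t) * ((11 + t) * K) * 6 + 3 * K * (3 * (5 * (11 + t)))
                  + (11 + t) * K * (21 + 17 * t + t * t)
                ≡ suc (11 + t) * ((11 + t) * ((11 + t) * K))
  slack = solve-∀

co<co-star : ∀ {k p} {H : Family (2 + k)} → 11 ≤ k → 1 ≤ p → Is3Uniform H → Intersecting H →
  (∀ v → Avoidable H v) → ∀ {F₀} → H F₀ ≡ true → co p H < co p (star {2 + k})
co<co-star {k} {p} {H} 11≤k 1≤p uniform intersecting avoidable HF₀ =
  <-≤-trans (bound<coStar p 1≤p) (≤-reflexive (sym (co-star {suc k} p)))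
  where
  open Uncovered uniform intersecting avoidable
  6≤k : 6 ≤ k
  6≤k = ≤-trans (m≤m+n 6 5) 11≤k
  bound<coStar : ∀ p′ → 1 ≤ p′ → co p′ H < coStar (suc k) p′
  bound<coStar (suc zero)    _ = ≤-<-trans (co₁≤ 6≤k HF₀) (uncoveredBound₁<coStar 11≤k)
  bound<coStar (suc (suc q)) _ = ≤-<-trans (co₂₊≤ 6≤k HF₀ q) (uncoveredBound<coStar q 11≤k)

lemma3p8 : (n p : ℕ) → 13 ≤ n → 1 ≤ p → (H : Family n) → Is3Uniform H → MatchingNumberIs H 1
    → (co p H ≤ co p (star {n})) × ((co p H ≡ co p (star {n})) ⇔ Iso H (star {n}))
lemma3p8 (suc (suc k)) p (s≤s (s≤s 11≤k)) 1≤p H uniform ν≡1 with covered-or-avoidable H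
... | inj₁ (v , covers) = co≤co-star p , mk⇔ (co≡co-star⇒Iso p 1≤p) (Iso⇒co≡ p)
  where open Covered uniform covers
... | inj₂ avoidable = <⇒≤ co< , mk⇔ (flip contradiction co≢) (flip contradiction co≢ ∘ Iso⇒co≡ p)
  where
  co< : co p H < co p (star {2 + k})
  co< = co<co-star 11≤k 1≤p uniform (ν≡1⇒intersecting uniform ν≡1) avoidable (proj₂ (ν≡1⇒member ν≡1))
  co≢ : co p H ≢ co p (star {2 + k})
  co≢ = <⇒≢ co<
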